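{- Let $w\ge 5$, $t\in[2,w-2]$, and $\tilde h>2w^3$ be integers, let $n'=\tilde h(w-1)$, and let $\{a_0=0,a_1,\dots,a_{w-2}\}$ be an $(\tilde h,w-1)$ modular Golomb ruler, with each $a_s$ viewed as an integer in $[0,\tilde h-1]$. Index positions by $\mathbb Z_{n'}$ and compute all positions below modulo $n'$. Define the following vectors in $\{0,1,2\}^{\mathbb Z_{n'}}$, each specified by its support and labels: (1) for $i\in[0,t-2]$ and $j\in[0,\tilde h-1]$, $\bm a_{i,j}$ has support $\{(a_s+j)(w-1)+i: s\in[0,w-2]\}$, with the position $(a_{w-2}+j)(w-1)+i$ labeled $2$ and all other support positions labeled $1$; (2) for $i\in[0,w-t-1]$ and $j\in[0,\tilde h-1]$, $\bm b_{i,j}$ has support $\{(si+j)(w-1)+s-1: s\in[1,w-1]\}$, with the position $((t+i)i+j)(w-1)+(t+i-1)$ labeled $2$ and all other support positions labeled $1$. Let $\mathcal H=\{\bm a_{i,j}\}\cup\{\bm b_{i,j}\}$. Then $\mathcal H$ is an $(n',2w-2,w)_3$ code; moreover, exactly $\tilde h(w-t)$ positions $v\in\mathbb Z_{n'}$ satisfy $R(v)=w-t$, and all other positions satisfy $R(v)=2w-t-1$.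
   Context: An $(m,k)$ modular Golomb ruler is a set of $k$ elements of $\mathbb Z_m$ whose pairwise differences $a_i-a_j$ ($i\ne j$) are nonzero and pairwise distinct in $\mathbb Z_m$. For vectors in $\{0,1,2\}^{n'}$, the $\ell_1$-distance is $\sum|u_i-v_i|$ and the $\ell_1$-weight is the distance to $\bm 0$; an $(n',d,w)_3$ code is a set of such vectors each of $\ell_1$-weight $w$ with pairwise $\ell_1$-distances at least $d$. Here each codeword of $\mathcal H$ has exactly one entry $2$ and $w-2$ entries $1$ (type $1^{w-2}2^1$), and for a position $v$, $R(v)$ denotes the number of codewords of $\mathcal H$ whose support contains $v$. -}

module Defs where

open import Data.Nat using (ℕ; zero; suc; _+_; _*_; _∸_; _%_; _≡ᵇ_; ∣_-_∣)
open import Data.Bool using (Bool; true; false; if_then_else_; _∨_)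
open import Data.Fin using (Fin; toℕ)
open import Data.Product using (_×_)
open import Data.Sum using (_⊎_; inj₁; inj₂)
open import Relation.Binary.PropositionalEquality using (_≡_; _≢_)

-- reduction modulo n (positions in ℤ_n represented by 0..n-1);
-- for n = 0 (never used under the hypotheses) it is the identity
modN : ℕ → ℕ → ℕ
modN zero    x = x
modN (suc n) x = x % suc n

sumBelow : ℕ → (ℕ → ℕ) → ℕ
sumBelow zero    f = 0
sumBelow (suc k) f = sumBelow k f + f k

sumFin : (n : ℕ) → (Fin n → ℕ) → ℕ
sumFin zero    f = 0
sumFin (suc n) f = f Fin.zero + sumFin n (λ i → f (Fin.suc i))

anyBelow : ℕ → (ℕ → Bool) → Bool
anyBelow zero    p = false
anyBelow (suc k) p = anyBelow k p ∨ p k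

-- (m,k) modular Golomb ruler, elements a 0, …, a (k-1) (viewed in ℤ_m):
-- pairwise differences a_i - a_j (i ≠ j) are nonzero and pairwise distinct in ℤ_m.
-- "a_i - a_j ≡ a_i' - a_j' (mod m)" is written as a_i + a_j' ≡ a_i' + a_j (mod m).
ModGolomb : (m k : ℕ) → (ℕ → ℕ) → Set
ModGolomb m k a =
  (∀ i j → i Data.Nat.< k → j Data.Nat.< k → i ≢ j → modN m (a i) ≢ modN m (a j)) ×
  (∀ i j i' j' → i Data.Nat.< k → j Data.Nat.< k → i' Data.Nat.< k → j' Data.Nat.< k →
     i ≢ j → i' ≢ j' → modN m (a i + a j') ≡ modN m (a i' + a j) → (i ≡ i') × (j ≡ j'))

vecFrom : (n k : ℕ) → (ℕ → ℕ) → ℕ → Fin n → ℕ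
vecFrom n k supp two v =
  if toℕ v ≡ᵇ modN n two then 2
  else (if anyBelow k (λ s → toℕ v ≡ᵇ modN n (supp s)) then 1 else 0)

dist : (n : ℕ) → (Fin n → ℕ) → (Fin n → ℕ) → ℕ
dist n u v = sumFin n (λ i → ∣ u i - v i ∣)

weight : (n : ℕ) → (Fin n → ℕ) → ℕ
weight n u = sumFin n u

len : (w h : ℕ) → ℕ
len w h = h * (w ∸ 1)

aVec : (w h : ℕ) → (ℕ → ℕ) → ℕ → ℕ → Fin (len w h) → ℕ
aVec w h a i j =
  vecFrom (len w h) (w ∸ 1)
    (λ s → (a s + j) * (w ∸ 1) + i)
    ((a (w ∸ 2) + j) * (w ∸ 1) + i)

-- b_{i,j}: support {(s i + j)(w-1) + s - 1 : s ∈ [1,w-1]} (written with s = s'+1, s' < w-1),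
-- 2 at ((t+i) i + j)(w-1) + (t+i-1)
bVec : (w t h : ℕ) → ℕ → ℕ → Fin (len w h) → ℕ
bVec w t h i j =
  vecFrom (len w h) (w ∸ 1)
    (λ s' → ((suc s') * i + j) * (w ∸ 1) + s')
    (((t + i) * i + j) * (w ∸ 1) + (t + i ∸ 1))

Idx : (w t h : ℕ) → Set
Idx w t h = (Fin (t ∸ 1) × Fin h) ⊎ (Fin (w ∸ t) × Fin h)

H : (w t h : ℕ) → (ℕ → ℕ) → Idx w t h → Fin (len w h) → ℕ
H w t h a (inj₁ (Data.Product._,_ i j)) = aVec w h a (toℕ i) (toℕ j)
H w t h a (inj₂ (Data.Product._,_ i j)) = bVec w t h (toℕ i) (toℕ j)

nz : ℕ → ℕ
nz zero    = 0
nz (suc _) = 1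

R : (w t h : ℕ) → (ℕ → ℕ) → Fin (len w h) → ℕ
R w t h a v =
  sumFin (t ∸ 1) (λ i → sumFin h (λ j → nz (aVec w h a (toℕ i) (toℕ j) v))) +
  sumFin (w ∸ t) (λ i → sumFin h (λ j → nz (bVec w t h (toℕ i) (toℕ j) v)))

countR : (w t h : ℕ) → (ℕ → ℕ) → ℕ → ℕ
countR w t h a r = sumFin (len w h) (λ v → if R w t h a v ≡ᵇ r then 1 else 0)

-- A codeword is the indicator of a (w−1)-element support with one position doubled, so it has
-- weight w, and two of them are at distance 2w − 2·Σ_v min(u_v, u'_v), which is ≥ 2w − 2 as soon
-- as their doubled positions differ and their supports share at most one position.
-- Writing a position as X(w−1) + r with X ∈ ℤ_h̃ and r < w−1, the support of a_{i,j} is the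
-- translate by j of the ruler inside the residue class r = i, so two a-words meet at most once by
-- the Golomb property; b_{i,j} meets each residue class r once, in block X = (r+1)i + j, and two
-- such lines meet at most once because h̃ > 2w³ rules out wrap-around.
-- The same picture computes R(X(w−1) + r): each i ≤ w−t−1 gives exactly one b_{i,j}, and when
-- r ≤ t−2 each ruler element gives exactly one a_{r,j}.
module Submission where

open import Defs
open import Data.Nat using (ℕ; zero; suc; _+_; _*_; _∸_; _^_; _≤_; _<_; _≥_; z≤n; s≤s; _≡ᵇ_; _⊓_; ∣_-_∣; _%_; _/_; _≟_; _<?_; NonZero)
open import Data.Nat.Properties hiding (_≟_; _<?_)
open import Data.Nat.DivMod
open import Data.Nat.Solver using (module +-*-Solver)
open import Data.Bool using (Bool; true; false; T; if_then_else_; _∧_)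
open import Data.Bool.Properties using (∨-zeroʳ; ∨-identityʳ)
open import Data.Fin using (Fin; toℕ)
open import Data.Fin.Properties using (toℕ<n; toℕ-injective)
open import Data.Product using (_×_; _,_; proj₁; proj₂; Σ-syntax)
open import Data.Sum using (_⊎_; inj₁; inj₂)
open import Data.Empty using (⊥-elim)
open import Relation.Nullary using (yes; no)
open import Relation.Nullary.Decidable using (dec-true; dec-false)
open import Function using (_∘_; case_of_)
open import Relation.Binary.PropositionalEquality
open +-*-Solver using (solve; _:=_; con; _:+_; _:*_)

𝟙 : Bool → ℕ
𝟙 b = if b then 1 else 0

nz-𝟙 : ∀ b → nz (𝟙 b) ≡ 𝟙 b
nz-𝟙 true  = refl
nz-𝟙 false = refl

𝟙≤1 : ∀ b → 𝟙 b ≤ 1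
𝟙≤1 true  = s≤s z≤n
𝟙≤1 false = z≤n

≡ᵇ-true⇒≡ : ∀ x y → (x ≡ᵇ y) ≡ true → x ≡ y
≡ᵇ-true⇒≡ x y e = ≡ᵇ⇒≡ x y (subst T (sym e) _)

≡ᵇ-refl : ∀ x → (x ≡ᵇ x) ≡ true
≡ᵇ-refl x = dec-true (x ≟ x) refl

≢⇒≡ᵇ-false : ∀ x y → x ≢ y → (x ≡ᵇ y) ≡ false
≢⇒≡ᵇ-false x y = dec-false (x ≟ y)

∧-true : ∀ {b c} → (b ∧ c) ≡ true → b ≡ true × c ≡ true
∧-true {true} {true} _ = refl , refl

∣m-n∣+2[m⊓n]≡m+n : ∀ m n → ∣ m - n ∣ + 2 * (m ⊓ n) ≡ m + n
∣m-n∣+2[m⊓n]≡m+n zero    n       = +-identityʳ n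
∣m-n∣+2[m⊓n]≡m+n (suc m) zero    = refl
∣m-n∣+2[m⊓n]≡m+n (suc m) (suc n) = begin
  ∣ m - n ∣ + 2 * suc (m ⊓ n)   ≡⟨ cong (∣ m - n ∣ +_) (*-suc 2 (m ⊓ n)) ⟩
  ∣ m - n ∣ + (2 + 2 * (m ⊓ n)) ≡⟨ +-comm ∣ m - n ∣ _ ⟩
  2 + (2 * (m ⊓ n) + ∣ m - n ∣) ≡⟨ cong (2 +_) (+-comm _ ∣ m - n ∣) ⟩
  2 + (∣ m - n ∣ + 2 * (m ⊓ n)) ≡⟨ cong (2 +_) (∣m-n∣+2[m⊓n]≡m+n m n) ⟩
  2 + (m + n)                   ≡⟨ cong suc (+-suc m n) ⟨
  suc m + suc n                 ∎
  where open ≡-Reasoning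

quotRem-injective : ∀ m .{{_ : NonZero m}} q q' {r r'} → r < m → r' < m →
  q * m + r ≡ q' * m + r' → r ≡ r' × q ≡ q'
quotRem-injective m q q' {r} {r'} r<m r'<m e =
  r≡r' , *-cancelʳ-≡ q q' m (+-cancelʳ-≡ r _ _ (trans e (cong (q' * m +_) (sym r≡r'))))
  where
  remainder : ∀ q r → r < m → (q * m + r) % m ≡ r
  remainder q r r<m = trans (cong (_% m) (+-comm (q * m) r)) (trans ([m+kn]%n≡m%n r q m) (m<n⇒m%n≡m r<m))
  r≡r' : r ≡ r'
  r≡r' = trans (sym (remainder q r r<m)) (trans (cong (_% m) e) (remainder q' r' r'<m))

m*p+n*q≡m*q+n*p⇒m≡n⊎p≡q : ∀ m n p q → m * p + n * q ≡ m * q + n * p → m ≡ n ⊎ p ≡ q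
m*p+n*q≡m*q+n*p⇒m≡n⊎p≡q zero    zero    p q e = inj₁ refl
m*p+n*q≡m*q+n*p⇒m≡n⊎p≡q zero    (suc n) p q e = inj₂ (sym (*-cancelˡ-≡ q p (suc n) e))
m*p+n*q≡m*q+n*p⇒m≡n⊎p≡q (suc m) zero    p q e =
  inj₂ (*-cancelˡ-≡ p q (suc m) (trans (sym (+-identityʳ _)) (trans e (+-identityʳ _))))
m*p+n*q≡m*q+n*p⇒m≡n⊎p≡q (suc m) (suc n) p q e
  with m*p+n*q≡m*q+n*p⇒m≡n⊎p≡q m n p q (+-cancelˡ-≡ (p + q) _ _ (begin
    (p + q) + (m * p + n * q)    ≡⟨ expand m n p q ⟩
    suc m * p + suc n * q        ≡⟨ e ⟩
    suc m * q + suc n * p        ≡⟨ expand m n q p ⟨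
    (q + p) + (m * q + n * p)    ≡⟨ cong (_+ (m * q + n * p)) (+-comm q p) ⟩
    (p + q) + (m * q + n * p)    ∎))
  where
  open ≡-Reasoning
  expand : ∀ m n p q → (p + q) + (m * p + n * q) ≡ suc m * p + suc n * q
  expand = solve 4 (λ m n p q → (p :+ q) :+ (m :* p :+ n :* q) := (con 1 :+ m) :* p :+ (con 1 :+ n) :* q) refl
... | inj₁ m≡n = inj₁ (cong suc m≡n)
... | inj₂ p≡q = inj₂ p≡q

m+[m∸n]≡2[1+m]∸[1+n]∸1 : ∀ m n → n ≤ m → m + (m ∸ n) ≡ 2 * suc m ∸ suc n ∸ 1
m+[m∸n]≡2[1+m]∸[1+n]∸1 m n n≤m = begin
  m + (m ∸ n)             ≡⟨ +-∸-assoc m n≤m ⟨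
  suc (m + m) ∸ (1 + n)   ≡⟨ cong (suc (m + m) ∸_) (+-comm 1 n) ⟩
  suc (m + m) ∸ (n + 1)   ≡⟨ ∸-+-assoc (suc (m + m)) n 1 ⟨
  2 + (m + m) ∸ suc n ∸ 1 ≡⟨ cong (λ x → x ∸ suc n ∸ 1) (solve 1 (λ m → con 2 :+ (m :+ m) := con 2 :* (con 1 :+ m)) refl m) ⟩
  2 * suc m ∸ suc n ∸ 1   ∎
  where open ≡-Reasoning

2[m*m]≤2[1+m]^3 : ∀ m → m * m + m * m ≤ 2 * suc m ^ 3
2[m*m]≤2[1+m]^3 m = +-mono-≤ m*m≤ (≤-trans m*m≤ (≤-reflexive (sym (+-identityʳ _))))
  where
  m*m≤ : m * m ≤ suc m ^ 3
  m*m≤ = ≤-trans (*-mono-≤ (n≤1+n m) (n≤1+n m)) (*-monoʳ-≤ (suc m) (m≤m*n (suc m) (suc m * 1)))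

sumBelow-cong : ∀ n {f g : ℕ → ℕ} → (∀ x → x < n → f x ≡ g x) → sumBelow n f ≡ sumBelow n g
sumBelow-cong zero    e = refl
sumBelow-cong (suc n) e = cong₂ _+_ (sumBelow-cong n (λ x x<n → e x (m<n⇒m<1+n x<n))) (e n ≤-refl)

sumBelow-mono-≤ : ∀ n {f g : ℕ → ℕ} → (∀ x → x < n → f x ≤ g x) → sumBelow n f ≤ sumBelow n g
sumBelow-mono-≤ zero    e = z≤n
sumBelow-mono-≤ (suc n) e = +-mono-≤ (sumBelow-mono-≤ n (λ x x<n → e x (m<n⇒m<1+n x<n))) (e n ≤-refl)

sumBelow-const : ∀ n c → sumBelow n (λ _ → c) ≡ n * c
sumBelow-const zero    c = refl
sumBelow-const (suc n) c = trans (cong (_+ c) (sumBelow-const n c)) (+-comm (n * c) c)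

sumBelow-1 : ∀ n → sumBelow n (λ _ → 1) ≡ n
sumBelow-1 n = trans (sumBelow-const n 1) (*-identityʳ n)

sumBelow-0 : ∀ n {f : ℕ → ℕ} → (∀ x → x < n → f x ≡ 0) → sumBelow n f ≡ 0
sumBelow-0 n e = trans (sumBelow-cong n e) (trans (sumBelow-const n 0) (*-zeroʳ n))

sumBelow-distrib-+ : ∀ n f g → sumBelow n (λ x → f x + g x) ≡ sumBelow n f + sumBelow n g
sumBelow-distrib-+ zero    f g = refl
sumBelow-distrib-+ (suc n) f g = begin
  sumBelow n (λ x → f x + g x) + (f n + g n)      ≡⟨ cong (_+ (f n + g n)) (sumBelow-distrib-+ n f g) ⟩
  (sumBelow n f + sumBelow n g) + (f n + g n)     ≡⟨ +-assoc (sumBelow n f) _ _ ⟩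
  sumBelow n f + (sumBelow n g + (f n + g n))     ≡⟨ cong (sumBelow n f +_) (+-comm (sumBelow n g) _) ⟩
  sumBelow n f + ((f n + g n) + sumBelow n g)     ≡⟨ cong (sumBelow n f +_) (+-assoc (f n) (g n) _) ⟩
  sumBelow n f + (f n + (g n + sumBelow n g))     ≡⟨ +-assoc (sumBelow n f) (f n) _ ⟨
  (sumBelow n f + f n) + (g n + sumBelow n g)     ≡⟨ cong (sumBelow n f + f n +_) (+-comm (g n) _) ⟩
  (sumBelow n f + f n) + (sumBelow n g + g n)     ∎
  where open ≡-Reasoning

sumBelow-*ˡ : ∀ n c f → sumBelow n (λ x → c * f x) ≡ c * sumBelow n f
sumBelow-*ˡ zero    c f = sym (*-zeroʳ c)
sumBelow-*ˡ (suc n) c f = trans (cong (_+ c * f n) (sumBelow-*ˡ n c f)) (sym (*-distribˡ-+ c (sumBelow n f) (f n)))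

sumBelow-comm : ∀ n k (f : ℕ → ℕ → ℕ) →
  sumBelow n (λ x → sumBelow k (f x)) ≡ sumBelow k (λ s → sumBelow n (λ x → f x s))
sumBelow-comm zero    k f = sym (sumBelow-0 k (λ _ _ → refl))
sumBelow-comm (suc n) k f = trans (cong (_+ sumBelow k (f n)) (sumBelow-comm n k f))
  (sym (sumBelow-distrib-+ k (λ s → sumBelow n (λ x → f x s)) (f n)))

sumBelow-split : ∀ a b g → sumBelow (a + b) g ≡ sumBelow a g + sumBelow b (λ x → g (a + x))
sumBelow-split a zero    g = trans (cong (λ c → sumBelow c g) (+-identityʳ a)) (sym (+-identityʳ _))
sumBelow-split a (suc b) g = begin
  sumBelow (a + suc b) g                                           ≡⟨ cong (λ c → sumBelow c g) (+-suc a b) ⟩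
  sumBelow (a + b) g + g (a + b)                                   ≡⟨ cong (_+ g (a + b)) (sumBelow-split a b g) ⟩
  sumBelow a g + sumBelow b (λ x → g (a + x)) + g (a + b)          ≡⟨ +-assoc (sumBelow a g) _ _ ⟩
  sumBelow a g + (sumBelow b (λ x → g (a + x)) + g (a + b))        ∎
  where open ≡-Reasoning

sumBelow-blocks : ∀ q m f → sumBelow (q * m) f ≡ sumBelow q (λ X → sumBelow m (λ r → f (X * m + r)))
sumBelow-blocks zero    m f = refl
sumBelow-blocks (suc q) m f = begin
  sumBelow (m + q * m) f                                         ≡⟨ cong (λ c → sumBelow c f) (+-comm m (q * m)) ⟩
  sumBelow (q * m + m) f                                         ≡⟨ sumBelow-split (q * m) m f ⟩
  sumBelow (q * m) f + sumBelow m (λ r → f (q * m + r))          ≡⟨ cong (_+ sumBelow m (λ r → f (q * m + r))) (sumBelow-blocks q m f) ⟩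
  sumBelow q (λ X → sumBelow m (λ r → f (X * m + r))) + sumBelow m (λ r → f (q * m + r)) ∎
  where open ≡-Reasoning

sumBelow-select : ∀ k r (f : ℕ → ℕ) → r < k → sumBelow k (λ s → 𝟙 (r ≡ᵇ s) * f s) ≡ f r
sumBelow-select-≥ : ∀ k r (f : ℕ → ℕ) → k ≤ r → sumBelow k (λ s → 𝟙 (r ≡ᵇ s) * f s) ≡ 0

sumBelow-select (suc k) r f r<1+k with r ≟ k
... | yes refl rewrite ≡ᵇ-refl r = trans (cong (_+ (f r + 0)) (sumBelow-select-≥ k r f ≤-refl)) (+-identityʳ (f r))
... | no r≢k rewrite ≢⇒≡ᵇ-false r k r≢k = trans (+-identityʳ _) (sumBelow-select k r f (≤∧≢⇒< (≤-pred r<1+k) r≢k))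

sumBelow-select-≥ k r f k≤r = sumBelow-0 k λ s s<k →
  cong (λ b → 𝟙 b * f s) (≢⇒≡ᵇ-false r s (λ r≡s → <-irrefl (sym r≡s) (<-≤-trans s<k k≤r)))

sumFin-toℕ : ∀ n g → sumFin n (λ v → g (toℕ v)) ≡ sumBelow n g
sumFin-toℕ zero    g = refl
sumFin-toℕ (suc n) g = begin
  g 0 + sumFin n (λ v → g (suc (toℕ v)))  ≡⟨ cong (g 0 +_) (sumFin-toℕ n (g ∘ suc)) ⟩
  g 0 + sumBelow n (g ∘ suc)              ≡⟨ shift n ⟨
  sumBelow (suc n) g                      ∎
  where
  open ≡-Reasoning
  shift : ∀ n → sumBelow (suc n) g ≡ g 0 + sumBelow n (g ∘ suc)
  shift zero    = +-comm 0 (g 0)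
  shift (suc n) = trans (cong (_+ g (suc n)) (shift n)) (+-assoc (g 0) _ _)

sumFin-cong : ∀ n {f g : Fin n → ℕ} → (∀ v → f v ≡ g v) → sumFin n f ≡ sumFin n g
sumFin-cong zero    e = refl
sumFin-cong (suc n) e = cong₂ _+_ (e Fin.zero) (sumFin-cong n (λ v → e (Fin.suc v)))

count : ℕ → (ℕ → Bool) → ℕ
count k P = sumBelow k (λ s → 𝟙 (P s))

AtMostOne : ℕ → (ℕ → Bool) → Set
AtMostOne k P = ∀ x y → x < k → y < k → P x ≡ true → P y ≡ true → x ≡ y

atMostOne-pred : ∀ {k P} → AtMostOne (suc k) P → AtMostOne k P
atMostOne-pred u x y x<k y<k = u x y (m<n⇒m<1+n x<k) (m<n⇒m<1+n y<k)

anyBelow-intro : ∀ k P {s} → s < k → P s ≡ true → anyBelow k P ≡ true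
anyBelow-intro (suc k) P {s} s<1+k Ps with s ≟ k
... | yes refl rewrite Ps = ∨-zeroʳ (anyBelow k P)
... | no s≢k rewrite anyBelow-intro k P (≤∧≢⇒< (≤-pred s<1+k) s≢k) Ps = refl

anyBelow-witness : ∀ k P → anyBelow k P ≡ true → Σ[ s ∈ ℕ ] s < k × P s ≡ true
anyBelow-witness (suc k) P any with P k in Pk
... | true = k , ≤-refl , Pk
... | false with anyBelow k P in any′
...   | true = let s , s<k , Ps = anyBelow-witness k P any′ in s , m<n⇒m<1+n s<k , Ps
anyBelow-witness (suc k) P () | false | false

count-others≡0 : ∀ {k P} → AtMostOne (suc k) P → P k ≡ true → count k P ≡ 0
count-others≡0 {k} {P} u Pk = sumBelow-0 k others
  where
  others : ∀ x → x < k → 𝟙 (P x) ≡ 0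
  others x x<k with P x in Px
  ... | false = refl
  ... | true  = ⊥-elim (<-irrefl (u x k (m<n⇒m<1+n x<k) ≤-refl Px Pk) x<k)

𝟙-anyBelow≡count : ∀ k P → AtMostOne k P → 𝟙 (anyBelow k P) ≡ count k P
𝟙-anyBelow≡count zero    P u = refl
𝟙-anyBelow≡count (suc k) P u with P k in Pk
... | false rewrite ∨-identityʳ (anyBelow k P) =
  trans (𝟙-anyBelow≡count k P (atMostOne-pred u)) (sym (+-identityʳ _))
... | true  rewrite ∨-zeroʳ (anyBelow k P) = cong (_+ 1) (sym (count-others≡0 u Pk))

count≤1 : ∀ k P → AtMostOne k P → count k P ≤ 1
count≤1 k P u = subst (_≤ 1) (𝟙-anyBelow≡count k P u) (𝟙≤1 (anyBelow k P))

count≡1 : ∀ k P {x} → AtMostOne k P → x < k → P x ≡ true → count k P ≡ 1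
count≡1 k P u x<k Px = trans (sym (𝟙-anyBelow≡count k P u)) (cong 𝟙 (anyBelow-intro k P x<k Px))

-- Defs.vecFrom, read on positions that are already reduced modulo n.
markedVector : ℕ → (ℕ → ℕ) → ℕ → ℕ → ℕ
markedVector k pos mark x = if x ≡ᵇ pos mark then 2 else 𝟙 (anyBelow k (λ s → x ≡ᵇ pos s))

record MarkedSupport (n k : ℕ) : Set where
  field
    pos           : ℕ → ℕ
    mark          : ℕ
    mark<k        : mark < k
    pos<n         : ∀ s → s < k → pos s < n
    pos-injective : ∀ s s' → s < k → s' < k → pos s ≡ pos s' → s ≡ s'

  isPos : ℕ → ℕ → Bool
  isPos x s = x ≡ᵇ pos s

  member : ℕ → Bool
  member x = anyBelow k (isPos x)

  vector : ℕ → ℕ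
  vector = markedVector k pos mark

  multiplicity : ℕ → ℕ
  multiplicity x = count k (isPos x)

  isPos-atMostOne : ∀ x → AtMostOne k (isPos x)
  isPos-atMostOne x s s' s<k s'<k e e' = pos-injective s s' s<k s'<k (trans (sym (≡ᵇ-true⇒≡ x _ e)) (≡ᵇ-true⇒≡ x _ e'))

  𝟙-member≡multiplicity : ∀ x → 𝟙 (member x) ≡ multiplicity x
  𝟙-member≡multiplicity x = 𝟙-anyBelow≡count k (isPos x) (isPos-atMostOne x)

  member-mark : ∀ x → (x ≡ᵇ pos mark) ≡ true → member x ≡ true
  member-mark x e = anyBelow-intro k (isPos x) mark<k e

  vector-nonmember : ∀ x → member x ≡ false → vector x ≡ 0
  vector-nonmember x m with x ≡ᵇ pos mark in e
  ... | true  = case trans (sym (member-mark x e)) m of λ ()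
  ... | false = cong 𝟙 m

  vector-unmarked : ∀ x → (x ≡ᵇ pos mark) ≡ false → vector x ≤ 1
  vector-unmarked x e rewrite e = 𝟙≤1 (member x)

  vector≡multiplicity+𝟙 : ∀ x → vector x ≡ multiplicity x + 𝟙 (x ≡ᵇ pos mark)
  vector≡multiplicity+𝟙 x with x ≡ᵇ pos mark in e
  ... | true  = cong (_+ 1) (trans (cong 𝟙 (sym (member-mark x e))) (𝟙-member≡multiplicity x))
  ... | false = trans (𝟙-member≡multiplicity x) (sym (+-identityʳ _))

  nz-vector : ∀ x → nz (vector x) ≡ multiplicity x
  nz-vector x with x ≡ᵇ pos mark in e
  ... | true  = trans (cong 𝟙 (sym (member-mark x e))) (𝟙-member≡multiplicity x)
  ... | false = trans (nz-𝟙 (member x)) (𝟙-member≡multiplicity x)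

  sum-multiplicity : sumBelow n multiplicity ≡ k
  sum-multiplicity = begin
    sumBelow n multiplicity                           ≡⟨ sumBelow-comm n k (λ x s → 𝟙 (isPos x s)) ⟩
    sumBelow k (λ s → count n (λ x → x ≡ᵇ pos s))     ≡⟨ sumBelow-cong k hit-once ⟩
    sumBelow k (λ _ → 1)                              ≡⟨ sumBelow-1 k ⟩
    k                                                 ∎
    where
    open ≡-Reasoning
    hit-once : ∀ s → s < k → count n (λ x → x ≡ᵇ pos s) ≡ 1
    hit-once s s<k = count≡1 n _ (λ x y _ _ ex ey → trans (≡ᵇ-true⇒≡ x _ ex) (sym (≡ᵇ-true⇒≡ y _ ey)))
      (pos<n s s<k) (≡ᵇ-refl (pos s))

  weight-vector : sumBelow n vector ≡ suc k
  weight-vector = begin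
    sumBelow n vector                                                 ≡⟨ sumBelow-cong n (λ x _ → vector≡multiplicity+𝟙 x) ⟩
    sumBelow n (λ x → multiplicity x + 𝟙 (x ≡ᵇ pos mark))            ≡⟨ sumBelow-distrib-+ n _ _ ⟩
    sumBelow n multiplicity + count n (λ x → x ≡ᵇ pos mark)          ≡⟨ cong₂ _+_ sum-multiplicity mark-once ⟩
    k + 1                                                             ≡⟨ +-comm k 1 ⟩
    suc k                                                             ∎
    where
    open ≡-Reasoning
    mark-once : count n (λ x → x ≡ᵇ pos mark) ≡ 1
    mark-once = count≡1 n _ (λ x y _ _ ex ey → trans (≡ᵇ-true⇒≡ x _ ex) (sym (≡ᵇ-true⇒≡ y _ ey)))
      (pos<n mark mark<k) (≡ᵇ-refl (pos mark))

module _ {n k : ℕ} (W₁ W₂ : MarkedSupport n k) where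
  private
    module W₁ = MarkedSupport W₁
    module W₂ = MarkedSupport W₂

  MeetAtMostOnce : Set
  MeetAtMostOnce = ∀ s₁ s₂ s₁' s₂' → s₁ < k → s₂ < k → s₁' < k → s₂' < k →
    W₁.pos s₁ ≡ W₂.pos s₂ → W₁.pos s₁' ≡ W₂.pos s₂' → W₁.pos s₁ ≡ W₁.pos s₁'

  Separated : Set
  Separated = W₁.pos W₁.mark ≢ W₂.pos W₂.mark × MeetAtMostOnce

  inBoth : ℕ → Bool
  inBoth x = W₁.member x ∧ W₂.member x

  ⊓-vector≤𝟙-inBoth : W₁.pos W₁.mark ≢ W₂.pos W₂.mark →
    ∀ x → W₁.vector x ⊓ W₂.vector x ≤ 𝟙 (inBoth x)
  ⊓-vector≤𝟙-inBoth marks≢ x = by-membership _ _ refl refl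
    where
    by-membership : ∀ b₁ b₂ → W₁.member x ≡ b₁ → W₂.member x ≡ b₂ →
      W₁.vector x ⊓ W₂.vector x ≤ 𝟙 (b₁ ∧ b₂)
    by-membership false _    m₁ _  = ≤-trans (m⊓n≤m _ _) (≤-reflexive (W₁.vector-nonmember x m₁))
    by-membership true false _  m₂ = ≤-trans (m⊓n≤n _ _) (≤-reflexive (W₂.vector-nonmember x m₂))
    by-membership true true  _  _  with x ≟ W₁.pos W₁.mark
    ... | no  x≢₁ = ≤-trans (m⊓n≤m _ _) (W₁.vector-unmarked x (≢⇒≡ᵇ-false _ _ x≢₁))
    ... | yes x≡₁ = ≤-trans (m⊓n≤n _ _) (W₂.vector-unmarked x
                      (≢⇒≡ᵇ-false _ _ (λ x≡₂ → marks≢ (trans (sym x≡₁) x≡₂))))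

  count-inBoth≤1 : MeetAtMostOnce → count n inBoth ≤ 1
  count-inBoth≤1 meet = count≤1 n inBoth λ x y _ _ cx cy →
    let m₁x , m₂x = ∧-true cx
        m₁y , m₂y = ∧-true cy
        s₁ , s₁<k , x≡₁ = anyBelow-witness k _ m₁x
        s₂ , s₂<k , x≡₂ = anyBelow-witness k _ m₂x
        s₁' , s₁'<k , y≡₁ = anyBelow-witness k _ m₁y
        s₂' , s₂'<k , y≡₂ = anyBelow-witness k _ m₂y
        x≡ = ≡ᵇ-true⇒≡ x _ x≡₁
        y≡ = ≡ᵇ-true⇒≡ y _ y≡₁
    in trans x≡ (trans (meet s₁ s₂ s₁' s₂' s₁<k s₂<k s₁'<k s₂'<k
          (trans (sym x≡) (≡ᵇ-true⇒≡ x _ x≡₂)) (trans (sym y≡) (≡ᵇ-true⇒≡ y _ y≡₂))) (sym y≡))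

  distance-≥ : Separated → 2 * suc k ∸ 2 ≤ sumBelow n (λ x → ∣ W₁.vector x - W₂.vector x ∣)
  distance-≥ (marks≢ , meet) = begin
    2 * suc k ∸ 2         ≡⟨ cong (_∸ 2) (cong (suc k +_) (+-identityʳ (suc k))) ⟩
    suc k + suc k ∸ 2     ≡⟨ cong (_∸ 2) D+2M≡ ⟨
    D + 2 * M ∸ 2         ≤⟨ ∸-monoʳ-≤ (D + 2 * M) (*-monoʳ-≤ 2 M≤1) ⟩
    D + 2 * M ∸ 2 * M     ≡⟨ m+n∸n≡m D (2 * M) ⟩
    D                     ∎
    where
    open ≤-Reasoning
    D = sumBelow n (λ x → ∣ W₁.vector x - W₂.vector x ∣)
    M = sumBelow n (λ x → W₁.vector x ⊓ W₂.vector x)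
    M≤1 : M ≤ 1
    M≤1 = ≤-trans (sumBelow-mono-≤ n (λ x _ → ⊓-vector≤𝟙-inBoth marks≢ x)) (count-inBoth≤1 meet)
    D+2M≡ : D + 2 * M ≡ suc k + suc k
    D+2M≡ = begin-equality
      D + 2 * M
        ≡⟨ cong (D +_) (sumBelow-*ˡ n 2 _) ⟨
      D + sumBelow n (λ x → 2 * (W₁.vector x ⊓ W₂.vector x))
        ≡⟨ sumBelow-distrib-+ n _ _ ⟨
      sumBelow n (λ x → ∣ W₁.vector x - W₂.vector x ∣ + 2 * (W₁.vector x ⊓ W₂.vector x))
        ≡⟨ sumBelow-cong n (λ x _ → ∣m-n∣+2[m⊓n]≡m+n (W₁.vector x) (W₂.vector x)) ⟩
      sumBelow n (λ x → W₁.vector x + W₂.vector x)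
        ≡⟨ sumBelow-distrib-+ n _ _ ⟩
      sumBelow n W₁.vector + sumBelow n W₂.vector
        ≡⟨ cong₂ _+_ W₁.weight-vector W₂.weight-vector ⟩
      suc k + suc k ∎

separated-sym : ∀ {n k} (W₁ W₂ : MarkedSupport n k) → Separated W₁ W₂ → Separated W₂ W₁
separated-sym _ _ (marks≢ , meet) = (λ e → marks≢ (sym e)) , λ s₁ s₂ s₁' s₂' s₁<k s₂<k s₁'<k s₂'<k e e' →
  trans e (trans (meet s₂ s₁ s₂' s₁' s₂<k s₁<k s₂'<k s₁'<k (sym e) (sym e')) (sym e'))

module Modulo (h₀ : ℕ) where
  h : ℕ
  h = suc h₀

  infix 4 _≈_
  _≈_ : ℕ → ℕ → Set
  x ≈ y = x % h ≡ y % h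

  %-≈ : ∀ x → x % h ≈ x
  %-≈ x = m%n%n≡m%n x h

  +-cong-≈ : ∀ a b c d → a ≈ b → c ≈ d → a + c ≈ b + d
  +-cong-≈ a b c d a≈b c≈d = begin
    (a + c) % h             ≡⟨ %-distribˡ-+ a c h ⟩
    (a % h + c % h) % h     ≡⟨ cong₂ (λ x y → (x + y) % h) a≈b c≈d ⟩
    (b % h + d % h) % h     ≡⟨ %-distribˡ-+ b d h ⟨
    (b + d) % h             ∎
    where open ≡-Reasoning

  +-cancelʳ-≈ : ∀ a b c → a + c ≈ b + c → a ≈ b
  +-cancelʳ-≈ a b c e = begin
    a % h                     ≡⟨ [m+kn]%n≡m%n a c h ⟨
    (a + c * h) % h           ≡⟨ cong (_% h) (unfold a) ⟩
    ((a + c) + c * h₀) % h    ≡⟨ +-cong-≈ (a + c) (b + c) (c * h₀) (c * h₀) e refl ⟩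
    ((b + c) + c * h₀) % h    ≡⟨ cong (_% h) (unfold b) ⟨
    (b + c * h) % h           ≡⟨ [m+kn]%n≡m%n b c h ⟩
    b % h                     ∎
    where
    open ≡-Reasoning
    unfold : ∀ x → x + c * h ≡ (x + c) + c * h₀
    unfold x = trans (cong (x +_) (*-suc c h₀)) (sym (+-assoc x c (c * h₀)))

  ≈⇒≡ : ∀ {a b} → a < h → b < h → a ≈ b → a ≡ b
  ≈⇒≡ a<h b<h e = trans (sym (m<n⇒m%n≡m a<h)) (trans e (m<n⇒m%n≡m b<h))

  +-cancelˡ-≈ : ∀ c {j j'} → j < h → j' < h → c + j ≈ c + j' → j ≡ j'
  +-cancelˡ-≈ c {j} {j'} j<h j'<h e = ≈⇒≡ j<h j'<h (+-cancelʳ-≈ j j' c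
    (trans (cong (_% h) (+-comm j c)) (trans e (cong (_% h) (+-comm c j')))))

  -- Both hypotheses say P − Q ≡ j' − j ≡ R − S, in a subtraction-free form.
  ≈-exchange : ∀ P Q R S j j' → P + j ≈ Q + j' → R + j ≈ S + j' → P + S ≈ R + Q
  ≈-exchange P Q R S j j' e₁ e₂ = +-cancelʳ-≈ (P + S) (R + Q) (j + j') (begin
    ((P + S) + (j + j')) % h    ≡⟨ cong (_% h) (solve 4 (λ P S j j' → (P :+ S) :+ (j :+ j') := (P :+ j) :+ (S :+ j')) refl P S j j') ⟩
    ((P + j) + (S + j')) % h    ≡⟨ +-cong-≈ (P + j) (Q + j') (S + j') (R + j) e₁ (sym e₂) ⟩
    ((Q + j') + (R + j)) % h    ≡⟨ cong (_% h) (solve 4 (λ Q R j j' → (Q :+ j') :+ (R :+ j) := (R :+ Q) :+ (j :+ j')) refl Q R j j') ⟩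
    ((R + Q) + (j + j')) % h    ∎)
    where open ≡-Reasoning

  count-shifts : ∀ c {X} → X < h → count h (λ j → X ≡ᵇ (c + j) % h) ≡ 1
  count-shifts c {X} X<h = count≡1 h _
    (λ j j' j<h j'<h e e' → +-cancelˡ-≈ c j<h j'<h (trans (sym (≡ᵇ-true⇒≡ X _ e)) (≡ᵇ-true⇒≡ X _ e')))
    (m%n<n (X + (h ∸ c % h)) h) (subst (λ y → (X ≡ᵇ y) ≡ true) (sym shift-hits-X) (≡ᵇ-refl X))
    where
    open ≡-Reasoning
    j₀ = (X + (h ∸ c % h)) % h
    shift-hits-X : (c + j₀) % h ≡ X
    shift-hits-X = begin
      (c + j₀) % h                         ≡⟨ +-cong-≈ c (c % h) j₀ _ (sym (%-≈ c)) (%-≈ (X + (h ∸ c % h))) ⟩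
      (c % h + (X + (h ∸ c % h))) % h      ≡⟨ cong (_% h) (solve 3 (λ u x y → u :+ (x :+ y) := x :+ (u :+ y)) refl (c % h) X (h ∸ c % h)) ⟩
      (X + (c % h + (h ∸ c % h))) % h      ≡⟨ cong (λ y → (X + y) % h) (m+[n∸m]≡n (m%n≤n c h)) ⟩
      (X + h) % h                          ≡⟨ [m+n]%n≡m%n X h ⟩
      X % h                                ≡⟨ m<n⇒m%n≡m X<h ⟩
      X                                    ∎

toℕ-pair-≢ : ∀ {k l} {i i' : Fin k} {j j' : Fin l} → (i , j) ≢ (i' , j') → toℕ i ≡ toℕ i' → toℕ j ≢ toℕ j'
toℕ-pair-≢ ij≢ i≡i' j≡j' = ij≢ (cong₂ _,_ (toℕ-injective i≡i') (toℕ-injective j≡j'))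

module Construction (m₁ h₀ t₁ : ℕ) (a : ℕ → ℕ) (golomb : ModGolomb (suc h₀) (suc m₁) a)
                    (t₁≤m : t₁ ≤ suc m₁) where
  open Modulo h₀

  m n : ℕ
  m = suc m₁
  n = h * m

  %-block : ∀ X r → r < m → (X * m + r) % n ≡ X % h * m + r
  %-block X r r<m = trans ([m*n+o]%[p*n]≡[m*n]%[p*n]+o X h r<m) (cong (_+ r) (sym (m%n*o≡m*o%[n*o] X h m)))

  block-residue : ∀ X Y {r r'} → r < m → r' < m → (X * m + r) % n ≡ (Y * m + r') % n → r ≡ r' × X ≈ Y
  block-residue X Y {r} {r'} r<m r'<m e =
    quotRem-injective m (X % h) (Y % h) r<m r'<m (trans (sym (%-block X r r<m)) (trans e (%-block Y r' r'<m)))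

  𝟙-≡ᵇ-block : ∀ X Y r r' → r < m → r' < m →
    𝟙 (X * m + r ≡ᵇ (Y * m + r') % n) ≡ 𝟙 (r ≡ᵇ r') * 𝟙 (X ≡ᵇ Y % h)
  𝟙-≡ᵇ-block X Y r r' r<m r'<m with r ≟ r' | X ≟ Y % h
  ... | yes refl | yes refl rewrite %-block Y r r<m | ≡ᵇ-refl (Y % h * m + r) | ≡ᵇ-refl r | ≡ᵇ-refl (Y % h) = refl
  ... | no r≢r'  | _ rewrite ≢⇒≡ᵇ-false r r' r≢r' = cong 𝟙 (≢⇒≡ᵇ-false _ _ λ e →
        r≢r' (proj₁ (quotRem-injective m X (Y % h) r<m r'<m (trans e (%-block Y r' r'<m)))))
  ... | yes refl | no X≢Y rewrite ≢⇒≡ᵇ-false X (Y % h) X≢Y | *-zeroʳ (𝟙 (r ≡ᵇ r)) = cong 𝟙 (≢⇒≡ᵇ-false _ _ λ e →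
        X≢Y (proj₂ (quotRem-injective m X (Y % h) r<m r<m (trans e (%-block Y r r<m)))))

  aPos : ℕ → ℕ → ℕ → ℕ
  aPos i j s = ((a s + j) * m + i) % n

  bPos : ℕ → ℕ → ℕ → ℕ
  bPos i j s = ((suc s * i + j) * m + s) % n

  aVector bVector : ℕ → ℕ → ℕ → ℕ
  aVector i j = markedVector m (aPos i j) m₁
  bVector i j = markedVector m (bPos i j) (t₁ + i)

  aSupport : ∀ i j → i < m → MarkedSupport n m
  aSupport i j i<m = record
    { pos = aPos i j ; mark = m₁ ; mark<k = ≤-refl
    ; pos<n = λ s _ → m%n<n ((a s + j) * m + i) n
    ; pos-injective = λ s s' s<m s'<m e → ruler-distinct s s' s<m s'<m
        (+-cancelʳ-≈ (a s) (a s') j (proj₂ (block-residue (a s + j) (a s' + j) i<m i<m e))) }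
    where
    ruler-distinct : ∀ s s' → s < m → s' < m → a s ≈ a s' → s ≡ s'
    ruler-distinct s s' s<m s'<m e with s ≟ s'
    ... | yes s≡s' = s≡s'
    ... | no s≢s'  = ⊥-elim (proj₁ golomb s s' s<m s'<m s≢s' e)

  bSupport : ∀ i j → i < m ∸ t₁ → MarkedSupport n m
  bSupport i j i<m-t₁ = record
    { pos = bPos i j ; mark = t₁ + i
    ; mark<k = ≤-trans (+-monoʳ-< t₁ i<m-t₁) (≤-reflexive (m+[n∸m]≡n t₁≤m))
    ; pos<n = λ s _ → m%n<n ((suc s * i + j) * m + s) n
    ; pos-injective = λ s s' s<m s'<m e → proj₁ (block-residue (suc s * i + j) (suc s' * i + j) s<m s'<m e) }

  aa-separated : ∀ {i i' j j'} (i<m : i < m) (i'<m : i' < m) → j < h → j' < h → (i ≡ i' → j ≢ j') →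
    Separated (aSupport i j i<m) (aSupport i' j' i'<m)
  aa-separated {i} {i'} {j} {j'} i<m i'<m j<h j'<h ij≢ = marks≢ , meet
    where
    marks≢ : aPos i j m₁ ≢ aPos i' j' m₁
    marks≢ e = let i≡i' , same-block = block-residue (a m₁ + j) (a m₁ + j') i<m i'<m e
               in ij≢ i≡i' (+-cancelˡ-≈ (a m₁) j<h j'<h same-block)
    meet : MeetAtMostOnce (aSupport i j i<m) (aSupport i' j' i'<m)
    meet s₁ s₂ s₁' s₂' s₁<m s₂<m s₁'<m s₂'<m e e' =
      cong (aPos i j) (proj₁ (proj₂ golomb s₁ s₂ s₁' s₂' s₁<m s₂<m s₁'<m s₂'<m
        (distinct x) (distinct x') (≈-exchange (a s₁) (a s₂) (a s₁') (a s₂') j j' x x')))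
      where
      collision = block-residue (a s₁ + j) (a s₂ + j') i<m i'<m e
      x = proj₂ collision
      x' = proj₂ (block-residue (a s₁' + j) (a s₂' + j') i<m i'<m e')
      distinct : ∀ {u v} → a u + j ≈ a v + j' → u ≢ v
      distinct {u} y refl = ij≢ (proj₁ collision) (+-cancelˡ-≈ (a u) j<h j'<h y)

  ab-separated : ∀ {i i'} j j' (i<t₁ : i < t₁) (i'<m-t₁ : i' < m ∸ t₁) →
    Separated (aSupport i j (<-≤-trans i<t₁ t₁≤m)) (bSupport i' j' i'<m-t₁)
  ab-separated {i} {i'} j j' i<t₁ i'<m-t₁ = marks≢ , meet
    where
    i<m = <-≤-trans i<t₁ t₁≤m
    b = bSupport i' j' i'<m-t₁
    marks≢ : aPos i j m₁ ≢ bPos i' j' (t₁ + i')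
    marks≢ e = <-irrefl
      (proj₁ (block-residue (a m₁ + j) (suc (t₁ + i') * i' + j') i<m (MarkedSupport.mark<k b) e))
      (<-≤-trans i<t₁ (m≤m+n t₁ i'))
    meet : MeetAtMostOnce (aSupport i j i<m) b
    meet s₁ s₂ s₁' s₂' _ s₂<m _ s₂'<m e e' = trans e (trans (cong (bPos i' j') (trans (sym i≡s₂) i≡s₂')) (sym e'))
      where
      i≡s₂ = proj₁ (block-residue (a s₁ + j) (suc s₂ * i' + j') i<m s₂<m e)
      i≡s₂' = proj₁ (block-residue (a s₁' + j) (suc s₂' * i' + j') i<m s₂'<m e')

  bb-separated : m * m + m * m < h → ∀ {i i' j j'} (i<m-t₁ : i < m ∸ t₁) (i'<m-t₁ : i' < m ∸ t₁) →
    j < h → j' < h → (i ≡ i' → j ≢ j') → Separated (bSupport i j i<m-t₁) (bSupport i' j' i'<m-t₁)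
  bb-separated h>2m² {i} {i'} {j} {j'} i<m-t₁ i'<m-t₁ j<h j'<h ij≢ = marks≢ , meet
    where
    b = bSupport i j i<m-t₁
    b' = bSupport i' j' i'<m-t₁
    marks≢ : bPos i j (t₁ + i) ≢ bPos i' j' (t₁ + i')
    marks≢ e with block-residue (suc (t₁ + i) * i + j) (suc (t₁ + i') * i' + j')
                    (MarkedSupport.mark<k b) (MarkedSupport.mark<k b') e
    ... | same-residue , same-block with +-cancelˡ-≡ t₁ i i' same-residue
    ...   | refl = ij≢ refl (+-cancelˡ-≈ (suc (t₁ + i) * i) j<h j'<h same-block)
    -- Since h > 2m², the congruence of block indices below is an equality of natural numbers.
    small : ∀ s s' u v → s < m → s' < m → u < m → v < m → suc s * u + suc s' * v < h
    small s s' u v s<m s'<m u<m v<m = ≤-<-trans (+-mono-≤ (*-mono-≤ s<m (<⇒≤ u<m)) (*-mono-≤ s'<m (<⇒≤ v<m))) h>2m²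
    i<m = <-≤-trans i<m-t₁ (m∸n≤m m t₁)
    i'<m = <-≤-trans i'<m-t₁ (m∸n≤m m t₁)
    meet : MeetAtMostOnce b b'
    meet s₁ s₂ s₁' s₂' s₁<m s₂<m s₁'<m s₂'<m e e'
      with block-residue (suc s₁ * i + j) (suc s₂ * i' + j') s₁<m s₂<m e
         | block-residue (suc s₁' * i + j) (suc s₂' * i' + j') s₁'<m s₂'<m e'
    ... | refl , x | refl , x' with i ≟ i'
    ...   | yes refl = ⊥-elim (ij≢ refl (+-cancelˡ-≈ (suc s₁ * i) j<h j'<h x))
    ...   | no i≢i' with m*p+n*q≡m*q+n*p⇒m≡n⊎p≡q (suc s₁) (suc s₁') i i' (trans
              (≈⇒≡ (small s₁ s₁' i i' s₁<m s₁'<m i<m i'<m) (small s₁' s₁ i i' s₁'<m s₁<m i<m i'<m)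
                (≈-exchange (suc s₁ * i) (suc s₁ * i') (suc s₁' * i) (suc s₁' * i') j j' x x'))
              (+-comm (suc s₁' * i) (suc s₁ * i')))
    ...     | inj₁ s₁≡s₁' = cong (bPos i j) (suc-injective s₁≡s₁')
    ...     | inj₂ i≡i'   = ⊥-elim (i≢i' i≡i')

  aCoverage : ∀ X r → X < h → r < m →
    sumBelow t₁ (λ i → sumBelow h (λ j → nz (aVector i j (X * m + r)))) ≡ sumBelow t₁ (λ i → 𝟙 (r ≡ᵇ i) * m)
  aCoverage X r X<h r<m = sumBelow-cong t₁ λ i i<t₁ → let i<m = <-≤-trans i<t₁ t₁≤m in begin
    sumBelow h (λ j → nz (aVector i j x))
      ≡⟨ sumBelow-cong h (λ j _ → MarkedSupport.nz-vector (aSupport i j i<m) x) ⟩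
    sumBelow h (λ j → sumBelow m (λ s → 𝟙 (x ≡ᵇ aPos i j s)))
      ≡⟨ sumBelow-cong h (λ j _ → sumBelow-cong m (λ s _ → 𝟙-≡ᵇ-block X (a s + j) r i r<m i<m)) ⟩
    sumBelow h (λ j → sumBelow m (λ s → 𝟙 (r ≡ᵇ i) * 𝟙 (X ≡ᵇ (a s + j) % h)))
      ≡⟨ sumBelow-cong h (λ j _ → sumBelow-*ˡ m (𝟙 (r ≡ᵇ i)) _) ⟩
    sumBelow h (λ j → 𝟙 (r ≡ᵇ i) * sumBelow m (λ s → 𝟙 (X ≡ᵇ (a s + j) % h)))
      ≡⟨ sumBelow-*ˡ h (𝟙 (r ≡ᵇ i)) _ ⟩
    𝟙 (r ≡ᵇ i) * sumBelow h (λ j → sumBelow m (λ s → 𝟙 (X ≡ᵇ (a s + j) % h)))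
      ≡⟨ cong (𝟙 (r ≡ᵇ i) *_) (sumBelow-comm h m (λ j s → 𝟙 (X ≡ᵇ (a s + j) % h))) ⟩
    𝟙 (r ≡ᵇ i) * sumBelow m (λ s → count h (λ j → X ≡ᵇ (a s + j) % h))
      ≡⟨ cong (𝟙 (r ≡ᵇ i) *_) (sumBelow-cong m (λ s _ → count-shifts (a s) X<h)) ⟩
    𝟙 (r ≡ᵇ i) * sumBelow m (λ _ → 1)
      ≡⟨ cong (𝟙 (r ≡ᵇ i) *_) (sumBelow-1 m) ⟩
    𝟙 (r ≡ᵇ i) * m ∎
    where
    open ≡-Reasoning
    x = X * m + r

  bCoverage : ∀ X r → X < h → r < m →
    sumBelow (m ∸ t₁) (λ i → sumBelow h (λ j → nz (bVector i j (X * m + r)))) ≡ m ∸ t₁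
  bCoverage X r X<h r<m = trans (sumBelow-cong (m ∸ t₁) λ i i<m-t₁ → begin
    sumBelow h (λ j → nz (bVector i j x))
      ≡⟨ sumBelow-cong h (λ j _ → MarkedSupport.nz-vector (bSupport i j i<m-t₁) x) ⟩
    sumBelow h (λ j → sumBelow m (λ s → 𝟙 (x ≡ᵇ bPos i j s)))
      ≡⟨ sumBelow-cong h (λ j _ → sumBelow-cong m (λ s s<m → 𝟙-≡ᵇ-block X (suc s * i + j) r s r<m s<m)) ⟩
    sumBelow h (λ j → sumBelow m (λ s → 𝟙 (r ≡ᵇ s) * 𝟙 (X ≡ᵇ (suc s * i + j) % h)))
      ≡⟨ sumBelow-cong h (λ j _ → sumBelow-select m r (λ s → 𝟙 (X ≡ᵇ (suc s * i + j) % h)) r<m) ⟩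
    count h (λ j → X ≡ᵇ (suc r * i + j) % h)
      ≡⟨ count-shifts (suc r * i) X<h ⟩
    1 ∎) (sumBelow-1 (m ∸ t₁))
    where
    open ≡-Reasoning
    x = X * m + r

  coverage : ℕ → ℕ
  coverage x = sumBelow t₁ (λ i → sumBelow h (λ j → nz (aVector i j x)))
             + sumBelow (m ∸ t₁) (λ i → sumBelow h (λ j → nz (bVector i j x)))

  coverage-low : ∀ X r → X < h → r < t₁ → coverage (X * m + r) ≡ m + (m ∸ t₁)
  coverage-low X r X<h r<t₁ = cong₂ _+_
    (trans (aCoverage X r X<h r<m) (sumBelow-select t₁ r (λ _ → m) r<t₁)) (bCoverage X r X<h r<m)
    where r<m = <-≤-trans r<t₁ t₁≤m

  coverage-high : ∀ X r → X < h → t₁ ≤ r → r < m → coverage (X * m + r) ≡ m ∸ t₁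
  coverage-high X r X<h t₁≤r r<m = cong₂ _+_
    (trans (aCoverage X r X<h r<m) (sumBelow-select-≥ t₁ r (λ _ → m) t₁≤r)) (bCoverage X r X<h r<m)

  w t : ℕ
  w = suc m
  t = suc t₁

  word : Idx w t h → MarkedSupport n m
  word (inj₁ (i , j)) = aSupport (toℕ i) (toℕ j) (<-≤-trans (toℕ<n i) t₁≤m)
  word (inj₂ (i , j)) = bSupport (toℕ i) (toℕ j) (toℕ<n i)

  H≡vector : ∀ x v → H w t h a x v ≡ MarkedSupport.vector (word x) (toℕ v)
  H≡vector (inj₁ _) v = refl
  H≡vector (inj₂ _) v = refl

  weight-H : ∀ x → weight n (H w t h a x) ≡ w
  weight-H x = trans (sumFin-cong n (H≡vector x))
    (trans (sumFin-toℕ n (MarkedSupport.vector (word x))) (MarkedSupport.weight-vector (word x)))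

  word-separated : m * m + m * m < h → ∀ x y → x ≢ y → Separated (word x) (word y)
  word-separated _ (inj₁ (i , j)) (inj₁ (i' , j')) x≢y =
    aa-separated (<-≤-trans (toℕ<n i) t₁≤m) (<-≤-trans (toℕ<n i') t₁≤m) (toℕ<n j) (toℕ<n j') (toℕ-pair-≢ (λ e → x≢y (cong inj₁ e)))
  word-separated h>2m² (inj₂ (i , j)) (inj₂ (i' , j')) x≢y =
    bb-separated h>2m² (toℕ<n i) (toℕ<n i') (toℕ<n j) (toℕ<n j') (toℕ-pair-≢ (λ e → x≢y (cong inj₂ e)))
  word-separated _ (inj₁ (i , j)) (inj₂ (i' , j')) _ = ab-separated (toℕ j) (toℕ j') (toℕ<n i) (toℕ<n i')
  word-separated _ (inj₂ (i , j)) (inj₁ (i' , j')) _ =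
    separated-sym (word (inj₁ (i' , j'))) (word (inj₂ (i , j))) (ab-separated (toℕ j') (toℕ j) (toℕ<n i') (toℕ<n i))

  distance-H : m * m + m * m < h → ∀ x y → x ≢ y → dist n (H w t h a x) (H w t h a y) ≥ 2 * w ∸ 2
  distance-H h>2m² x y x≢y = subst (2 * w ∸ 2 ≤_) (sym (trans
    (sumFin-cong n (λ v → cong₂ ∣_-_∣ (H≡vector x v) (H≡vector y v)))
    (sumFin-toℕ n (λ z → ∣ MarkedSupport.vector (word x) z - MarkedSupport.vector (word y) z ∣))))
    (distance-≥ (word x) (word y) (word-separated h>2m² x y x≢y))

  R≡coverage : ∀ v → R w t h a v ≡ coverage (toℕ v)
  R≡coverage v = cong₂ _+_ (sumFin-sumFin-toℕ t₁ (λ i j → nz (aVector i j (toℕ v))))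
                           (sumFin-sumFin-toℕ (m ∸ t₁) (λ i j → nz (bVector i j (toℕ v))))
    where
    sumFin-sumFin-toℕ : ∀ k f → sumFin k (λ i → sumFin h (λ j → f (toℕ i) (toℕ j))) ≡ sumBelow k (λ i → sumBelow h (f i))
    sumFin-sumFin-toℕ k f = trans (sumFin-toℕ k (λ i → sumFin h (λ j → f i (toℕ j))))
      (sumBelow-cong k (λ i _ → sumFin-toℕ h (f i)))

  count-coverage-block : ∀ X → X < h → sumBelow m (λ r → 𝟙 (coverage (X * m + r) ≡ᵇ m ∸ t₁)) ≡ m ∸ t₁
  count-coverage-block X X<h = begin
    sumBelow m f                                         ≡⟨ cong (λ k → sumBelow k f) (m+[n∸m]≡n t₁≤m) ⟨
    sumBelow (t₁ + (m ∸ t₁)) f                           ≡⟨ sumBelow-split t₁ (m ∸ t₁) f ⟩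
    sumBelow t₁ f + sumBelow (m ∸ t₁) (λ k → f (t₁ + k)) ≡⟨ cong₂ _+_ (sumBelow-0 t₁ low) (sumBelow-cong (m ∸ t₁) high) ⟩
    sumBelow (m ∸ t₁) (λ _ → 1)                          ≡⟨ sumBelow-1 (m ∸ t₁) ⟩
    m ∸ t₁                                               ∎
    where
    open ≡-Reasoning
    f = λ r → 𝟙 (coverage (X * m + r) ≡ᵇ m ∸ t₁)
    low : ∀ r → r < t₁ → f r ≡ 0
    low r r<t₁ rewrite coverage-low X r X<h r<t₁ =
      cong 𝟙 (≢⇒≡ᵇ-false _ _ (λ e → case +-cancelʳ-≡ (m ∸ t₁) m 0 e of λ ()))
    high : ∀ k → k < m ∸ t₁ → f (t₁ + k) ≡ 1
    high k k<m-t₁ rewrite coverage-high X (t₁ + k) X<h (m≤m+n t₁ k)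
                            (<-≤-trans (+-monoʳ-< t₁ k<m-t₁) (≤-reflexive (m+[n∸m]≡n t₁≤m))) =
      cong 𝟙 (≡ᵇ-refl (m ∸ t₁))

  countR-H : countR w t h a (w ∸ t) ≡ h * (w ∸ t)
  countR-H = begin
    countR w t h a (m ∸ t₁)
      ≡⟨ sumFin-cong n (λ v → cong (λ c → 𝟙 (c ≡ᵇ m ∸ t₁)) (R≡coverage v)) ⟩
    sumFin n (λ v → 𝟙 (coverage (toℕ v) ≡ᵇ m ∸ t₁))
      ≡⟨ sumFin-toℕ n (λ x → 𝟙 (coverage x ≡ᵇ m ∸ t₁)) ⟩
    sumBelow (h * m) (λ x → 𝟙 (coverage x ≡ᵇ m ∸ t₁))
      ≡⟨ sumBelow-blocks h m _ ⟩
    sumBelow h (λ X → sumBelow m (λ r → 𝟙 (coverage (X * m + r) ≡ᵇ m ∸ t₁)))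
      ≡⟨ sumBelow-cong h count-coverage-block ⟩
    sumBelow h (λ _ → m ∸ t₁)
      ≡⟨ sumBelow-const h (m ∸ t₁) ⟩
    h * (m ∸ t₁) ∎
    where open ≡-Reasoning

  R≡coverage-block : ∀ v → R w t h a v ≡ coverage (toℕ v / m * m + toℕ v % m)
  R≡coverage-block v = trans (R≡coverage v)
    (cong coverage (trans (m≡m%n+[m/n]*n (toℕ v) m) (+-comm (toℕ v % m) (toℕ v / m * m))))

  R-H : ∀ v → R w t h a v ≢ w ∸ t → R w t h a v ≡ 2 * w ∸ t ∸ 1
  R-H v R≢ with toℕ v % m <? t₁
  ... | yes r<t₁ = begin
    R w t h a v                           ≡⟨ R≡coverage-block v ⟩
    coverage (toℕ v / m * m + toℕ v % m)  ≡⟨ coverage-low _ _ (m<n*o⇒m/o<n (toℕ<n v)) r<t₁ ⟩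
    m + (m ∸ t₁)                          ≡⟨ m+[m∸n]≡2[1+m]∸[1+n]∸1 m t₁ t₁≤m ⟩
    2 * w ∸ t ∸ 1                         ∎
    where open ≡-Reasoning
  ... | no r≮t₁ = ⊥-elim (R≢ (trans (R≡coverage-block v)
    (coverage-high _ _ (m<n*o⇒m/o<n (toℕ<n v)) (≮⇒≥ r≮t₁) (m%n<n (toℕ v) m))))

proposition1 : (w t h : ℕ) (a : ℕ → ℕ) →
    5 ≤ w → 2 ≤ t → t ≤ w ∸ 2 → 2 * w ^ 3 < h →
    ModGolomb h (w ∸ 1) a → a 0 ≡ 0 → (∀ s → s ≤ w ∸ 2 → a s < h) →
    ((∀ x → weight (len w h) (H w t h a x) ≡ w) ×
     (∀ x y → x ≢ y → dist (len w h) (H w t h a x) (H w t h a y) ≥ 2 * w ∸ 2)) ×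
    (countR w t h a (w ∸ t) ≡ h * (w ∸ t)) ×
    (∀ v → R w t h a v ≢ w ∸ t → R w t h a v ≡ 2 * w ∸ t ∸ 1)
proposition1 (suc (suc m₁)) (suc t₁) (suc h₀) a (s≤s (s≤s _)) _ t≤w-2 h>2w³ golomb _ _ =
  (weight-H , distance-H (≤-<-trans (2[m*m]≤2[1+m]^3 (suc m₁)) h>2w³)) , countR-H , R-H
  where
  open Construction m₁ h₀ t₁ a golomb (≤-trans (n≤1+n t₁) (≤-trans t≤w-2 (n≤1+n m₁)))
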